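{- Let $C_1$ be a positive squarefree integer and $q$ a prime. Let $(x,y,\alpha,p)$ be a solution of $C_1x^2+q^\alpha=y^p$ with $\gcd(C_1x,q,y)=1$, $x,y,\alpha>0$, $y$ even and $p\ge 11$ prime. Let $\ell$ be a prime with $\ell=2mp+1$ for some integer $m>0$ and $\ell\nmid 2qC_1y$, and let $\beta$ be the unique integer in $\{0,1,\dots,2p-1\}$ with $\beta\equiv\alpha\pmod{2p}$. Then there exists $\omega\in\{0,1,\dots,\ell-1\}$ with $(C_1\omega^2+q^\beta)^{2m}\equiv 1\pmod\ell$ such that the reduction of $F_{x,\alpha}$ over $\mathbb{F}_\ell$ is either isomorphic to the curve \[F_{\omega,\beta}/\mathbb{F}_\ell:\ Y^2+XY=X^3+\frac{C_1\omega-1}{4}X^2+\frac{C_1^2\omega^2+C_1q^\beta}{64}X,\] or to the quadratic twist of it by $q\bmod\ell$.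
   Context: $F_{x,\alpha}$ is the elliptic curve $Y^2+XY=X^3+\frac{C_1x-1}{4}X^2+\frac{C_1^2x^2+C_1q^\alpha}{64}X$ over $\mathbb{Q}$. -}

module Defs where

open import Data.Nat as ℕ using (ℕ)
open import Data.Nat.Divisibility as ℕD using ()
open import Data.Integer using (ℤ; +_; _+_; _-_; _*_; _^_)
open import Data.Integer.Divisibility using (_∣_)
open import Data.Product using (Σ; _×_; _,_)
open import Relation.Binary.PropositionalEquality using (_≡_)
open import Relation.Nullary using (¬_)

SquareFree : ℕ → Set
SquareFree n = ∀ (d : ℕ) → (d ℕ.* d) ℕD.∣ n → d ≡ 1

infix 4 _≡_[mod_]
_≡_[mod_] : ℤ → ℤ → ℕ → Set
a ≡ b [mod ℓ ] = (+ ℓ) ∣ (a - b)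

-- inverse of a modulo a prime ℓ (with ℓ ∤ a), via Fermat: a^(ℓ-2)
inv : ℕ → ℤ → ℤ
inv ℓ a = a ^ (ℓ ℕ.∸ 2)

-- Weierstrass equation Y²+a1XY+a3Y = X³+a2X²+a4X+a6, coefficients (a1,a2,a3,a4,a6)
record Weierstrass : Set where
  constructor W
  field
    a1 a2 a3 a4 a6 : ℤ
open Weierstrass public

-- isomorphism of Weierstrass equations over F_ℓ (Silverman, Table 3.1):
-- X = u²X' + r, Y = u³Y' + su²X' + t, u ≠ 0 in F_ℓ, taking E to E'
IsoMod : ℕ → Weierstrass → Weierstrass → Set
IsoMod ℓ E E' =
  Σ ℤ λ u → Σ ℤ λ r → Σ ℤ λ s → Σ ℤ λ t →
    ¬ (u ≡ (+ 0) [mod ℓ ]) ×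
    (u * a1 E' ≡ a1 E + (+ 2) * s [mod ℓ ]) ×
    (u ^ 2 * a2 E' ≡ a2 E - s * a1 E + (+ 3) * r - s * s [mod ℓ ]) ×
    (u ^ 3 * a3 E' ≡ a3 E + r * a1 E + (+ 2) * t [mod ℓ ]) ×
    (u ^ 4 * a4 E' ≡ a4 E - s * a3 E + (+ 2) * r * a2 E - (t + r * s) * a1 E
                      + (+ 3) * r * r - (+ 2) * s * t [mod ℓ ]) ×
    (u ^ 6 * a6 E' ≡ a6 E + r * a4 E + r * r * a2 E + r * r * r - t * a3 E
                      - t * t - r * t * a1 E [mod ℓ ])

-- quadratic twist by d over F_ℓ (ℓ odd): E ≅ Y² = X³ + (b2/4)X² + (b4/2)X + b6/4,
-- twist is Y² = X³ + d(b2/4)X² + d²(b4/2)X + d³(b6/4)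
twist : ℕ → ℤ → Weierstrass → Weierstrass
twist ℓ d E = W (+ 0) (d * b2 * inv ℓ (+ 4)) (+ 0) (d ^ 2 * b4 * inv ℓ (+ 2))
                (d ^ 3 * b6 * inv ℓ (+ 4))
  where
  b2 = a1 E * a1 E + (+ 4) * a2 E
  b4 = (+ 2) * a4 E + a1 E * a3 E
  b6 = a3 E * a3 E + (+ 4) * a6 E

Fmod : ℕ → ℕ → ℕ → ℤ → ℕ → Weierstrass
Fmod ℓ C₁ q x α =
  W (+ 1) (((+ C₁) * x - (+ 1)) * inv ℓ (+ 4)) (+ 0)
    (((+ C₁) ^ 2 * x ^ 2 + (+ C₁) * (+ q) ^ α) * inv ℓ (+ 64)) (+ 0)

{-# OPTIONS --safe #-}

-- Write α = β + 2e with p ∣ e and put t = q^e. Choosing ω ≡ x/t (mod ℓ) gives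
-- t²(C₁ω² + q^β) ≡ C₁x² + q^α = y^p. Since ℓ - 1 = 2mp, (t²)^(2m) and (y^p)^(2m) are powers
-- of q^(ℓ-1) and y^(ℓ-1), so Fermat's little theorem yields (C₁ω² + q^β)^(2m) ≡ 1.
-- The relations x ≡ tω and q^α = q^β t² say that F_{x,α} is F_{ω,β} rescaled by t: for e even,
-- t = u² and X = u²X′, Y = u³Y′ + su²X′ with s = (u - 1)/2 is an isomorphism; for e odd,
-- t = q u², and the same substitution with s = -1/2 completes the square and lands on the
-- twist by q. Only these facts about ℓ, the equation, and β ≡ α (mod 2p) are needed.

module Submission where

module Fermat where

  open import Data.Nat
  open import Data.Nat.Properties
  open import Data.Nat.Divisibility
  open import Data.Nat.Primality using (Prime; euclidsLemma)
  open import Data.Nat.Combinatorics using (_C_; nC1≡n; nCn≡1; nCk+nC[k+1]≡[n+1]C[k+1])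
  open import Data.Nat.Tactic.RingSolver using (solve-∀)
  open import Data.Fin as Fin using (Fin; toℕ; inject₁; fromℕ)
  open import Data.Fin.Properties using (toℕ-inject₁; toℕ-fromℕ; toℕ<n)
  open import Data.Vec.Functional using (Vector; init; tail)
  open import Data.Product using (∃-syntax; _,_)
  open import Data.Sum using (inj₁; inj₂)
  open import Data.Empty using (⊥-elim)
  open import Relation.Binary.PropositionalEquality
  open import Algebra.Definitions.RawMonoid +-0-rawMonoid using (sum) renaming (_×_ to _×ₛ_)
  open import Algebra.Definitions.RawSemiring +-*-rawSemiring using () renaming (_^_ to _^ₛ_)
  open import Algebra.Properties.Monoid.Sum +-0-monoid using (sum-init-last)
  import Algebra.Properties.CommutativeSemiring.Binomial +-*-commutativeSemiring as Binomial

  -- The library's binomial theorem is stated with the semiring-generic ℕ-action and power.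
  ×ₛ≡* : ∀ m n → m ×ₛ n ≡ m * n
  ×ₛ≡* zero    n = refl
  ×ₛ≡* (suc m) n = cong (n +_) (×ₛ≡* m n)

  ^ₛ≡^ : ∀ m n → m ^ₛ n ≡ m ^ n
  ^ₛ≡^ m zero    = refl
  ^ₛ≡^ m (suc n) = cong (m *_) (^ₛ≡^ m n)

  ∣-sum : ∀ {d n} (t : Vector ℕ n) → (∀ i → d ∣ t i) → d ∣ sum t
  ∣-sum {n = zero}  t d∣t = _ ∣0
  ∣-sum {n = suc n} t d∣t = ∣m∣n⇒∣m+n (d∣t _) (∣-sum (tail t) (λ i → d∣t (Fin.suc i)))

  C-absorption : ∀ n k → suc k * (suc n C suc k) ≡ suc n * (n C k)
  C-absorption zero    zero    = refl
  C-absorption zero    (suc k) = *-zeroʳ (suc (suc k))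
  C-absorption (suc n) zero    =
    trans (+-identityʳ _) (trans (nC1≡n (suc (suc n))) (sym (*-identityʳ (suc (suc n)))))
  C-absorption (suc n) (suc k) = begin
    suc (suc k) * (suc (suc n) C suc (suc k))
      ≡⟨ cong (suc (suc k) *_) (nCk+nC[k+1]≡[n+1]C[k+1] (suc n) (suc k)) ⟨
    suc (suc k) * (X + Y)
      ≡⟨ distrib k X Y ⟩
    suc k * X + X + suc (suc k) * Y
      ≡⟨ cong₂ (λ a b → a + X + b) (C-absorption n k) (C-absorption n (suc k)) ⟩
    suc n * (n C k) + X + suc n * (n C suc k)
      ≡⟨ regroup (suc n) (n C k) (n C suc k) X ⟩
    suc n * (n C k + n C suc k) + X
      ≡⟨ cong (λ z → suc n * z + X) (nCk+nC[k+1]≡[n+1]C[k+1] n k) ⟩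
    suc n * X + X
      ≡⟨ +-comm (suc n * X) X ⟩
    suc (suc n) * X ∎
    where
    open ≡-Reasoning
    X Y : ℕ
    X = suc n C suc k
    Y = suc n C suc (suc k)
    distrib : ∀ k X Y → suc (suc k) * (X + Y) ≡ suc k * X + X + suc (suc k) * Y
    distrib = solve-∀
    regroup : ∀ a b c X → a * b + X + a * c ≡ a * (b + c) + X
    regroup = solve-∀

  p∣pCk : ∀ {p k} → Prime p → 0 < k → k < p → p ∣ p C k
  p∣pCk {suc n} {suc k} p-prime _ k<p with euclidsLemma (suc k) (suc n C suc k) p-prime
    (divides (n C k) (trans (C-absorption n k) (*-comm (suc n) (n C k))))
  ... | inj₁ p∣k = ⊥-elim (<⇒≱ k<p (∣⇒≤ p∣k))
  ... | inj₂ p∣C = p∣C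

  module _ (a : ℕ) where
    open Binomial using (binomialTerm)

    term : ∀ p → Fin (suc p) → ℕ
    term p = binomialTerm a 1 p

    first-term : ∀ p → term p Fin.zero ≡ 1
    first-term p = begin
      1 * 1 ^ₛ p + 0 ≡⟨ +-identityʳ _ ⟩
      1 * 1 ^ₛ p     ≡⟨ *-identityˡ _ ⟩
      1 ^ₛ p         ≡⟨ ^ₛ≡^ 1 p ⟩
      1 ^ p          ≡⟨ ^-zeroˡ p ⟩
      1 ∎
      where open ≡-Reasoning

    last-term : ∀ p → term p (fromℕ p) ≡ a ^ p
    last-term p rewrite toℕ-fromℕ p | nCn≡1 p | n∸n≡0 p = begin
      a ^ₛ p * 1 + 0 ≡⟨ +-identityʳ _ ⟩
      a ^ₛ p * 1     ≡⟨ *-identityʳ _ ⟩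
      a ^ₛ p         ≡⟨ ^ₛ≡^ a p ⟩
      a ^ p ∎
      where open ≡-Reasoning

    p∣middle-term : ∀ {p} → Prime (suc p) → (i : Fin p) → suc p ∣ term (suc p) (Fin.suc (inject₁ i))
    p∣middle-term {p} p-prime i = subst (suc p ∣_) (sym (×ₛ≡* (suc p C suc (toℕ (inject₁ i))) z))
      (∣m⇒∣m*n z (p∣pCk p-prime z<s (s<s (subst (_< p) (sym (toℕ-inject₁ i)) (toℕ<n i)))))
      where
      z : ℕ
      z = Binomial.binomial a 1 (suc p) (Fin.suc (inject₁ i))

    freshmans-dream : ∀ {p} → Prime p → ∃[ c ] (1 + a) ^ p ≡ 1 + a ^ p + c * p
    freshmans-dream {suc p} p-prime
      with ∣-sum (init (tail (term (suc p)))) (p∣middle-term p-prime)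
    ... | divides c middle≡ = c , (begin
      (1 + a) ^ suc p                                 ≡⟨ cong (_^ suc p) (+-comm 1 a) ⟩
      (a + 1) ^ suc p                                 ≡⟨ ^ₛ≡^ (a + 1) (suc p) ⟨
      (a + 1) ^ₛ suc p                                ≡⟨ Binomial.theorem (suc p) a 1 ⟩
      term (suc p) Fin.zero + sum (tail (term (suc p)))
        ≡⟨ cong₂ _+_ (first-term (suc p)) (sum-init-last (tail (term (suc p)))) ⟩
      1 + (sum (init (tail (term (suc p)))) + term (suc p) (fromℕ (suc p)))
        ≡⟨ cong₂ (λ m l → 1 + (m + l)) middle≡ (last-term (suc p)) ⟩
      1 + (c * suc p + a ^ suc p)                     ≡⟨ cong (1 +_) (+-comm (c * suc p) _) ⟩
      1 + (a ^ suc p + c * suc p)                     ∎)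
      where open ≡-Reasoning

  fermat-little : ∀ {p} → Prime p → ∀ a → ∃[ c ] a ^ p ≡ a + c * p
  fermat-little {suc p} p-prime zero    = 0 , refl
  fermat-little {p}     p-prime (suc a) with fermat-little p-prime a | freshmans-dream a p-prime
  ... | c₀ , a^p≡ | c₁ , [1+a]^p≡ = c₀ + c₁ , (begin
    (1 + a) ^ p               ≡⟨ [1+a]^p≡ ⟩
    1 + a ^ p + c₁ * p        ≡⟨ cong (λ z → 1 + z + c₁ * p) a^p≡ ⟩
    1 + (a + c₀ * p) + c₁ * p ≡⟨ regroup a c₀ c₁ p ⟩
    1 + a + (c₀ + c₁) * p     ∎)
    where
    open ≡-Reasoning
    regroup : ∀ a c₀ c₁ p → 1 + (a + c₀ * p) + c₁ * p ≡ 1 + a + (c₀ + c₁) * p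
    regroup = solve-∀

module Modular where

  open import Data.Nat as ℕ using (ℕ; zero; suc)
  import Data.Nat.Properties as ℕ
  import Data.Nat.Divisibility as ℕ
  open import Data.Nat.DivMod using (_%_; _/_; m≡m%n+[m/n]*n; m%n<n)
  open import Data.Nat.Primality using (Prime; euclidsLemma)
  open import Data.Integer using (ℤ; +_; _+_; _-_; _*_; _^_; -_; 0ℤ; 1ℤ; ∣_∣; _⊖_)
  open import Data.Integer.Properties
    using ( pos-+; pos-*; abs-*; *-zeroʳ; +-inverseʳ; ^-*-assoc; ^-zeroˡ; ^-distribˡ-+-*
          ; m-n≡m⊖n; ⊖-≥; ∣⊖∣-<)
  open import Data.Integer.Divisibility.Signed
    using (_∣_; ∣-refl; ∣ᵤ⇒∣; ∣⇒∣ᵤ; ∣m∣n⇒∣m+n; ∣n⇒∣m*n)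
  open import Data.Integer.Tactic.RingSolver using (solve-∀)
  open import Data.Nat.Tactic.RingSolver using () renaming (solve-∀ to ℕ-solve-∀)
  open import Data.Product using (∃-syntax; _×_; _,_; proj₁; proj₂)
  open import Data.Sum using (_⊎_; inj₁; inj₂; [_,_]′)
  open import Data.Empty using (⊥-elim)
  open import Function using (_∘_)
  open import Relation.Binary.PropositionalEquality
  open import Relation.Nullary using (¬_)
  open import Defs
  open Fermat using (fermat-little)

  pos-^ : ∀ m n → + (m ℕ.^ n) ≡ (+ m) ^ n
  pos-^ m zero    = refl
  pos-^ m (suc n) = trans (pos-* m (m ℕ.^ n)) (cong (+ m *_) (pos-^ m n))

  ^-distribʳ-* : ∀ a b n → (a * b) ^ n ≡ a ^ n * b ^ n
  ^-distribʳ-* a b zero    = refl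
  ^-distribʳ-* a b (suc n) =
    trans (cong (a * b *_) (^-distribʳ-* a b n)) (interchange a b (a ^ n) (b ^ n))
    where
    interchange : ∀ a b c d → a * b * (c * d) ≡ a * c * (b * d)
    interchange = solve-∀

  -- a ≡ b [mod n ] unfolds to divisibility of ∣ a - b ∣, from which Agda cannot recover a and b;
  -- this record keeps them visible to unification.
  infix 4 _≋_[mod_]

  record _≋_[mod_] (a b : ℤ) (n : ℕ) : Set where
    constructor ≋-by-∣
    field
      ∣-difference : + n ∣ a - b
  open _≋_[mod_] public

  -- A congruence a ≋ b is proved by a ring identity writing a - b as a combination of
  -- differences already known to be divisible by n, assembled with _⊕_ and _⊛_.
  module _ {n : ℕ} where

    ≋⇒≡[mod] : ∀ {a b} → a ≋ b [mod n ] → a ≡ b [mod n ]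
    ≋⇒≡[mod] a≋b = ∣⇒∣ᵤ (∣-difference a≋b)

    ≋-by : ∀ {a b z} → a - b ≡ z → + n ∣ z → a ≋ b [mod n ]
    ≋-by refl n∣z = ≋-by-∣ n∣z

    infixl 4 _⊕_
    infix  5 _⊛_

    _⊕_ : ∀ {y z} → + n ∣ y → + n ∣ z → + n ∣ y + z
    _⊕_ = ∣m∣n⇒∣m+n

    _⊛_ : ∀ c {a b} → a ≋ b [mod n ] → + n ∣ c * (a - b)
    c ⊛ a≋b = ∣n⇒∣m*n c (∣-difference a≋b)

    ≡⇒≋ : ∀ {a b} → a ≡ b → a ≋ b [mod n ]
    ≡⇒≋ {a} refl = ≋-by (+-inverseʳ a) (∣n⇒∣m*n 0ℤ ∣-refl)

    ^-cong : ∀ {a b} → a ≋ b [mod n ] → ∀ k → a ^ k ≋ b ^ k [mod n ]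
    ^-cong a≋b zero    = ≡⇒≋ refl
    ^-cong {a} {b} a≋b (suc k) =
      ≋-by (split a b (a ^ k) (b ^ k)) (a ⊛ ^-cong a≋b k ⊕ b ^ k ⊛ a≋b)
      where
      split : ∀ a b x y → a * x - b * y ≡ a * (x - y) + y * (a - b)
      split = solve-∀

    ^≋1-cancelˡ : ∀ {a b c} k → b ^ k ≋ 1ℤ [mod n ] → b * a ≋ c [mod n ] → c ^ k ≋ 1ℤ [mod n ] →
                  a ^ k ≋ 1ℤ [mod n ]
    ^≋1-cancelˡ {a} {b} {c} k bᵏ≋1 ba≋c cᵏ≋1 =
      ≋-by (split (a ^ k) (b ^ k) (c ^ k)) (1ℤ ⊛ bᵏaᵏ≋cᵏ ⊕ 1ℤ ⊛ cᵏ≋1 ⊕ - (a ^ k) ⊛ bᵏ≋1)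
      where
      bᵏaᵏ≋cᵏ : b ^ k * a ^ k ≋ c ^ k [mod n ]
      bᵏaᵏ≋cᵏ = subst (_≋ c ^ k [mod n ]) (^-distribʳ-* b a k) (^-cong ba≋c k)
      split : ∀ x y z → x - 1ℤ ≡ 1ℤ * (y * x - z) + 1ℤ * (z - 1ℤ) + - x * (y - 1ℤ)
      split = solve-∀

  ∤-* : ∀ {ℓ a b} → Prime ℓ → ¬ ℓ ℕ.∣ a → ¬ ℓ ℕ.∣ b → ¬ ℓ ℕ.∣ a ℕ.* b
  ∤-* ℓ-prime ℓ∤a ℓ∤b ℓ∣ab = [ ℓ∤a , ℓ∤b ]′ (euclidsLemma _ _ ℓ-prime ℓ∣ab)

  ∤-^ : ∀ {ℓ a} → Prime ℓ → ¬ ℓ ℕ.∣ a → ∀ k → ¬ ℓ ℕ.∣ a ℕ.^ k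
  ∤-^ {suc (suc l)} ℓ-prime ℓ∤a zero    ℓ∣1 = ℕ.<⇒≱ (ℕ.s≤s (ℕ.s≤s ℕ.z≤n)) (ℕ.∣⇒≤ ℓ∣1)
  ∤-^               ℓ-prime ℓ∤a (suc k) = ∤-* ℓ-prime ℓ∤a (∤-^ ℓ-prime ℓ∤a k)

  *-cancelˡ-≋ : ∀ {ℓ a x y} → Prime ℓ → ¬ ℓ ℕ.∣ a → + a * x ≋ + a * y [mod ℓ ] → x ≋ y [mod ℓ ]
  *-cancelˡ-≋ {ℓ} {a} {x} {y} ℓ-prime ℓ∤a ax≋ay =
    [ ⊥-elim ∘ ℓ∤a , ≋-by-∣ ∘ ∣ᵤ⇒∣ ]′ (euclidsLemma a ∣ x - y ∣ ℓ-prime ℓ∣a∣x-y∣)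
    where
    factor : ∀ a x y → a * x - a * y ≡ a * (x - y)
    factor = solve-∀
    ℓ∣a∣x-y∣ : ℓ ℕ.∣ a ℕ.* ∣ x - y ∣
    ℓ∣a∣x-y∣ = subst (ℓ ℕ.∣_) (trans (cong ∣_∣ (factor (+ a) x y)) (abs-* (+ a) (x - y)))
                 (∣⇒∣ᵤ (∣-difference ax≋ay))

  fermat-little-unit : ∀ {ℓ a} → Prime ℓ → ¬ ℓ ℕ.∣ a → (+ a) ^ (ℓ ℕ.∸ 1) ≋ 1ℤ [mod ℓ ]
  fermat-little-unit {suc l} {a} ℓ-prime ℓ∤a with fermat-little ℓ-prime a
  ... | c , aˡ⁺¹≡a+cℓ = *-cancelˡ-≋ ℓ-prime ℓ∤a (≋-by aˡ⁺¹-a≡cℓ (∣n⇒∣m*n (+ c) ∣-refl))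
    where
    cancel : ∀ a b → a + b - a * 1ℤ ≡ b
    cancel = solve-∀
    aˡ⁺¹-a≡cℓ : + a * (+ a) ^ l - + a * 1ℤ ≡ + c * + suc l
    aˡ⁺¹-a≡cℓ = begin
      (+ a) ^ suc l - + a * 1ℤ            ≡⟨ cong (_- + a * 1ℤ) (pos-^ a (suc l)) ⟨
      + (a ℕ.^ suc l) - + a * 1ℤ          ≡⟨ cong (λ z → + z - + a * 1ℤ) aˡ⁺¹≡a+cℓ ⟩
      + (a ℕ.+ c ℕ.* suc l) - + a * 1ℤ    ≡⟨ cong (_- + a * 1ℤ) (pos-+ a (c ℕ.* suc l)) ⟩
      + a + + (c ℕ.* suc l) - + a * 1ℤ    ≡⟨ cancel (+ a) _ ⟩
      + (c ℕ.* suc l)                     ≡⟨ pos-* c (suc l) ⟩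
      + c * + suc l                       ∎
      where open ≡-Reasoning

  -- For ℓ = 2 + l, + a * inv ℓ (+ a) is (+ a) ^ (1 + l) by definition.
  inv-inverse : ∀ {ℓ a} → Prime ℓ → ¬ ℓ ℕ.∣ a → + a * inv ℓ (+ a) ≋ 1ℤ [mod ℓ ]
  inv-inverse {suc (suc l)} = fermat-little-unit

  fermat-little-power : ∀ {ℓ a} → Prime ℓ → ¬ ℓ ℕ.∣ a → ∀ j →
                        (+ a) ^ ((ℓ ℕ.∸ 1) ℕ.* j) ≋ 1ℤ [mod ℓ ]
  fermat-little-power {ℓ} {a} ℓ-prime ℓ∤a j =
    subst₂ (_≋_[mod ℓ ]) (^-*-assoc (+ a) (ℓ ℕ.∸ 1) j) (^-zeroˡ j)
      (^-cong (fermat-little-unit ℓ-prime ℓ∤a) j)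

  %-≋ : ∀ {ℓ} .{{_ : ℕ.NonZero ℓ}} N → + (N % ℓ) ≋ + N [mod ℓ ]
  %-≋ {ℓ} N = ≋-by N%ℓ-N≡ (∣n⇒∣m*n (- + (N / ℓ)) ∣-refl)
    where
    cancel : ∀ r k l → r - (r + k * l) ≡ - k * l
    cancel = solve-∀
    N%ℓ-N≡ : + (N % ℓ) - + N ≡ - + (N / ℓ) * + ℓ
    N%ℓ-N≡ = begin
      + (N % ℓ) - + N
        ≡⟨ cong (λ z → + (N % ℓ) - + z) (m≡m%n+[m/n]*n N ℓ) ⟩
      + (N % ℓ) - + (N % ℓ ℕ.+ N / ℓ ℕ.* ℓ)
        ≡⟨ cong (λ z → + (N % ℓ) - z) (pos-+ (N % ℓ) _) ⟩
      + (N % ℓ) - (+ (N % ℓ) + + (N / ℓ ℕ.* ℓ))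
        ≡⟨ cong (λ z → + (N % ℓ) - (+ (N % ℓ) + z)) (pos-* (N / ℓ) ℓ) ⟩
      + (N % ℓ) - (+ (N % ℓ) + + (N / ℓ) * + ℓ)
        ≡⟨ cancel (+ (N % ℓ)) (+ (N / ℓ)) (+ ℓ) ⟩
      - + (N / ℓ) * + ℓ ∎
      where open ≡-Reasoning

  mod-quotient : ∀ {ℓ t} → Prime ℓ → ¬ ℓ ℕ.∣ t → ∀ x → ∃[ ω ] ω ℕ.< ℓ × + x ≋ + t * + ω [mod ℓ ]
  mod-quotient {ℓ@(suc _)} {t} ℓ-prime ℓ∤t x =
    N % ℓ , m%n<n N ℓ , ≋-by (split (+ x) (+ t) (+ (N % ℓ)) (inv ℓ (+ t)))
                              (- + t ⊛ ω≋x/t ⊕ - + x ⊛ inv-inverse ℓ-prime ℓ∤t)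
    where
    N : ℕ
    N = x ℕ.* t ℕ.^ (ℓ ℕ.∸ 2)
    ω≋x/t : + (N % ℓ) ≋ + x * inv ℓ (+ t) [mod ℓ ]
    ω≋x/t = subst (λ z → + (N % ℓ) ≋ z [mod ℓ ])
                  (trans (pos-* x (t ℕ.^ (ℓ ℕ.∸ 2))) (cong (+ x *_) (pos-^ t (ℓ ℕ.∸ 2)))) (%-≋ N)
    split : ∀ x t ω i → x - t * ω ≡ - t * (ω - x * i) + - x * (t * i - 1ℤ)
    split = solve-∀

  ≡[mod]⇒≡+* : ∀ {b n} a → b ℕ.< n → + a ≡ + b [mod n ] → ∃[ d ] a ≡ b ℕ.+ d ℕ.* n
  ≡[mod]⇒≡+* {b} {n} a b<n n∣a-b = [ b≤a⇒ , a<b⇒ ]′ (ℕ.≤-<-connex b a)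
    where
    n∣a⊖b : n ℕ.∣ ∣ a ⊖ b ∣
    n∣a⊖b = subst (λ z → n ℕ.∣ ∣ z ∣) (m-n≡m⊖n a b) n∣a-b
    b≤a⇒ : b ℕ.≤ a → ∃[ d ] a ≡ b ℕ.+ d ℕ.* n
    b≤a⇒ b≤a with subst (λ z → n ℕ.∣ ∣ z ∣) (⊖-≥ b≤a) n∣a⊖b
    ... | ℕ.divides d a∸b≡dn = d , trans (sym (ℕ.m+[n∸m]≡n b≤a)) (cong (b ℕ.+_) a∸b≡dn)
    a<b⇒ : a ℕ.< b → ∃[ d ] a ≡ b ℕ.+ d ℕ.* n
    a<b⇒ a<b = ⊥-elim (ℕ.<⇒≱ b<n (ℕ.≤-trans n≤b∸a (ℕ.m∸n≤m b a)))
      where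
      n≤b∸a : n ℕ.≤ b ℕ.∸ a
      n≤b∸a = ℕ.∣⇒≤ {{ℕ.>-nonZero (ℕ.m<n⇒0<n∸m a<b)}} (subst (n ℕ.∣_) (∣⊖∣-< a<b) n∣a⊖b)

  parity : ∀ n → ∃[ j ] (n ≡ j ℕ.+ j ⊎ n ≡ suc (j ℕ.+ j))
  parity zero    = 0 , inj₁ refl
  parity (suc n) with parity n
  ... | j , inj₁ n≡j+j   = j , inj₂ (cong suc n≡j+j)
  ... | j , inj₂ n≡1+j+j = suc j , inj₁ (cong suc (trans n≡1+j+j (sym (ℕ.+-suc j j))))

  ≡0[mod]⇒∣ : ∀ {ℓ n} → + n ≡ 0ℤ [mod ℓ ] → ℓ ℕ.∣ n
  ≡0[mod]⇒∣ {ℓ} {n} = subst (ℓ ℕ.∣_) (ℕ.+-identityʳ n)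

  ^≢0[mod] : ∀ {ℓ q} → Prime ℓ → ¬ ℓ ℕ.∣ q → ∀ j → ¬ ((+ q) ^ j ≡ 0ℤ [mod ℓ ])
  ^≢0[mod] {ℓ} {q} ℓ-prime ℓ∤q j qʲ≡0 =
    ∤-^ ℓ-prime ℓ∤q j (≡0[mod]⇒∣ (subst (λ z → z ≡ 0ℤ [mod ℓ ]) (sym (pos-^ q j)) qʲ≡0))

  -- The change of variables X = u²X′, Y = u³Y′ + su²X′ (r = t = 0 in IsoMod).
  shear-IsoMod : ∀ {ℓ} {E E′ : Weierstrass} (u s : ℤ) → ¬ (u ≡ 0ℤ [mod ℓ ]) →
    a3 E ≡ 0ℤ → a6 E ≡ 0ℤ → a3 E′ ≡ 0ℤ → a6 E′ ≡ 0ℤ →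
    u * a1 E′ ≋ a1 E + + 2 * s [mod ℓ ] →
    u * u * a2 E′ ≋ a2 E - s * a1 E - s * s [mod ℓ ] →
    u * u * (u * u) * a4 E′ ≋ a4 E [mod ℓ ] →
    IsoMod ℓ E E′
  shear-IsoMod {ℓ} {E} {E′} u s u≢0 a₃≡0 a₆≡0 a₃′≡0 a₆′≡0 a₁≋ a₂≋ a₄≋
    rewrite a₃≡0 | a₆≡0 | a₃′≡0 | a₆′≡0 =
    u , 0ℤ , s , 0ℤ , u≢0 ,
    ≋⇒≡[mod] a₁≋ ,
    ≋⇒≡[mod] a₂-eq ,
    ≋⇒≡[mod] (≡⇒≋ (a₃-identity u (a1 E))) ,
    ≋⇒≡[mod] a₄-eq ,
    ≋⇒≡[mod] (≡⇒≋ (a₆-identity u (a1 E) (a2 E) (a4 E)))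
    where
    a₂-identity : ∀ u s a₁ a₂ a₂′ → u * (u * 1ℤ) * a₂′ - (a₂ - s * a₁ + + 3 * 0ℤ - s * s)
                                    ≡ 1ℤ * (u * u * a₂′ - (a₂ - s * a₁ - s * s))
    a₂-identity = solve-∀
    a₃-identity : ∀ u a₁ → u * (u * (u * 1ℤ)) * 0ℤ ≡ 0ℤ + 0ℤ * a₁ + + 2 * 0ℤ
    a₃-identity = solve-∀
    a₄-identity : ∀ u s a₁ a₂ a₄ a₄′ →
      u * (u * (u * (u * 1ℤ))) * a₄′ - (a₄ - s * 0ℤ + + 2 * 0ℤ * a₂ - (0ℤ + 0ℤ * s) * a₁
                                            + + 3 * 0ℤ * 0ℤ - + 2 * s * 0ℤ)
        ≡ 1ℤ * (u * u * (u * u) * a₄′ - a₄)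
    a₄-identity = solve-∀
    a₆-identity : ∀ u a₁ a₂ a₄ → u * (u * (u * (u * (u * (u * 1ℤ))))) * 0ℤ
      ≡ 0ℤ + 0ℤ * a₄ + 0ℤ * 0ℤ * a₂ + 0ℤ * 0ℤ * 0ℤ - 0ℤ * 0ℤ - 0ℤ * 0ℤ - 0ℤ * 0ℤ * a₁
    a₆-identity = solve-∀
    a₂-eq : u ^ 2 * a2 E′ ≋ a2 E - s * a1 E + + 3 * 0ℤ - s * s [mod ℓ ]
    a₂-eq = ≋-by (a₂-identity u s (a1 E) (a2 E) (a2 E′)) (1ℤ ⊛ a₂≋)
    a₄-eq : u ^ 4 * a4 E′ ≋ a4 E - s * 0ℤ + + 2 * 0ℤ * a2 E - (0ℤ + 0ℤ * s) * a1 E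
                              + + 3 * 0ℤ * 0ℤ - + 2 * s * 0ℤ [mod ℓ ]
    a₄-eq = ≋-by (a₄-identity u s (a1 E) (a2 E) (a4 E) (a4 E′)) (1ℤ ⊛ a₄≋)

  module _ {ℓ : ℕ} (ℓ-prime : Prime ℓ) (ℓ∤2 : ¬ ℓ ℕ.∣ 2) where

    private
      h i₄ : ℤ
      h  = inv ℓ (+ 2)
      i₄ = inv ℓ (+ 4)

      two-inv : + 2 * h ≋ 1ℤ [mod ℓ ]
      two-inv = inv-inverse ℓ-prime ℓ∤2

      four-inv : + 4 * i₄ ≋ 1ℤ [mod ℓ ]
      four-inv = inv-inverse ℓ-prime (∤-* ℓ-prime ℓ∤2 ℓ∤2)

    shift-half : ∀ v → v ≋ 1ℤ + + 2 * ((v - 1ℤ) * h) [mod ℓ ]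
    shift-half v = ≋-by (identity v h) (- (v - 1ℤ) ⊛ two-inv)
      where
      identity : ∀ v h → v - (1ℤ + + 2 * ((v - 1ℤ) * h)) ≡ - (v - 1ℤ) * (+ 2 * h - 1ℤ)
      identity = solve-∀

    shift-half-square : ∀ v → let s = (v - 1ℤ) * h in s + s * s ≋ (v * v - 1ℤ) * i₄ [mod ℓ ]
    shift-half-square v =
      ≋-by (identity v h i₄) (i₄ * (+ 2 * (v - 1ℤ) + (v - 1ℤ) * (v - 1ℤ) * (+ 2 * h + 1ℤ)) ⊛ two-inv
                              ⊕ (i₄ * (1ℤ - v * v) - E) ⊛ four-inv)
      where
      E : ℤ
      E = (v - 1ℤ) * h + (v - 1ℤ) * h * ((v - 1ℤ) * h) - (v * v - 1ℤ) * i₄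
      identity : ∀ v h i₄ → let s = (v - 1ℤ) * h ; E = s + s * s - (v * v - 1ℤ) * i₄ in
        E ≡ i₄ * (+ 2 * (v - 1ℤ) + (v - 1ℤ) * (v - 1ℤ) * (+ 2 * h + 1ℤ)) * (+ 2 * h - 1ℤ)
            + (i₄ * (1ℤ - v * v) - E) * (+ 4 * i₄ - 1ℤ)
      identity = solve-∀

    Fmod-≅ : ∀ C₁ q α β {x ω : ℤ} (u t : ℤ) → ¬ (u ≡ 0ℤ [mod ℓ ]) → t ≡ u * u →
      x ≋ t * ω [mod ℓ ] → (+ q) ^ α ≋ (+ q) ^ β * (t * t) [mod ℓ ] →
      IsoMod ℓ (Fmod ℓ C₁ q x α) (Fmod ℓ C₁ q ω β)
    Fmod-≅ C₁ q α β {x} {ω} u t u≢0 refl x≋tω qᵅ≋ =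
      shear-IsoMod u s u≢0 refl refl refl refl
        (≋-by (a₁-identity u s) (1ℤ ⊛ shift-half u))
        (≋-by (a₂-identity c u s x ω i₄) (- (c * i₄) ⊛ x≋tω ⊕ 1ℤ ⊛ shift-half-square u))
        (≋-by (a₄-identity c u x ω ((+ q) ^ α) ((+ q) ^ β) i₆₄)
              (- (i₆₄ * c * c * (x + t * ω)) ⊛ x≋tω ⊕ - (i₆₄ * c) ⊛ qᵅ≋))
      where
      c s i₆₄ : ℤ
      c   = + C₁
      s   = (u - 1ℤ) * h
      i₆₄ = inv ℓ (+ 64)
      a₁-identity : ∀ u s → u * + 1 - (+ 1 + + 2 * s) ≡ 1ℤ * (u - (1ℤ + + 2 * s))
      a₁-identity = solve-∀
      a₂-identity : ∀ c u s x ω i₄ →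
        u * u * ((c * ω - + 1) * i₄) - ((c * x - + 1) * i₄ - s * + 1 - s * s)
          ≡ - (c * i₄) * (x - u * u * ω) + 1ℤ * (s + s * s - (u * u - 1ℤ) * i₄)
      a₂-identity = solve-∀
      a₄-identity : ∀ c u x ω Qa Qb i₆₄ →
        u * u * (u * u) * ((c * (c * 1ℤ) * (ω * (ω * 1ℤ)) + c * Qb) * i₆₄)
          - (c * (c * 1ℤ) * (x * (x * 1ℤ)) + c * Qa) * i₆₄
          ≡ - (i₆₄ * c * c * (x + u * u * ω)) * (x - u * u * ω)
            + - (i₆₄ * c) * (Qa - Qb * (u * u * (u * u)))
      a₄-identity = solve-∀

    Fmod-≅-twist : ∀ C₁ q α β {x ω : ℤ} (d u t : ℤ) → ¬ (u ≡ 0ℤ [mod ℓ ]) → t ≡ d * (u * u) →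
      x ≋ t * ω [mod ℓ ] → (+ q) ^ α ≋ (+ q) ^ β * (t * t) [mod ℓ ] →
      IsoMod ℓ (Fmod ℓ C₁ q x α) (twist ℓ d (Fmod ℓ C₁ q ω β))
    Fmod-≅-twist C₁ q α β {x} {ω} d u t u≢0 refl x≋tω qᵅ≋ =
      shear-IsoMod u s u≢0 refl refl refl (cong (_* i₄) (*-zeroʳ (d ^ 3)))
        (≋-by (a₁-identity u s) (1ℤ ⊛ shift-half 0ℤ))
        (≋-by (a₂-identity c d u s x ω i₄)
              (- (c * i₄) ⊛ x≋tω ⊕ u * u * d * i₄ * (c * ω - 1ℤ) ⊛ four-inv
               ⊕ 1ℤ ⊛ shift-half-square 0ℤ))
        (≋-by (a₄-identity c d u x ω ((+ q) ^ α) ((+ q) ^ β) h i₆₄)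
              (u * u * (u * u) * (d * d) * A₄ ⊛ two-inv
               ⊕ - (i₆₄ * c * c * (x + t * ω)) ⊛ x≋tω ⊕ - (i₆₄ * c) ⊛ qᵅ≋))
      where
      c s i₆₄ A₄ : ℤ
      c   = + C₁
      s   = (0ℤ - 1ℤ) * h
      i₆₄ = inv ℓ (+ 64)
      A₄  = a4 (Fmod ℓ C₁ q ω β)
      a₁-identity : ∀ u s → u * + 0 - (+ 1 + + 2 * s) ≡ 1ℤ * (0ℤ - (1ℤ + + 2 * s))
      a₁-identity = solve-∀
      a₂-identity : ∀ c d u s x ω i₄ →
        u * u * (d * (+ 1 + + 4 * ((c * ω - + 1) * i₄)) * i₄)
          - ((c * x - + 1) * i₄ - s * + 1 - s * s)
          ≡ - (c * i₄) * (x - d * (u * u) * ω) + u * u * d * i₄ * (c * ω - 1ℤ) * (+ 4 * i₄ - 1ℤ)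
            + 1ℤ * (s + s * s - (0ℤ * 0ℤ - 1ℤ) * i₄)
      a₂-identity = solve-∀
      a₄-identity : ∀ c d u x ω Qa Qb h i₆₄ →
        let A₄ = (c * (c * 1ℤ) * (ω * (ω * 1ℤ)) + c * Qb) * i₆₄ in
        u * u * (u * u) * (d * (d * 1ℤ) * (+ 2 * A₄ + + 0) * h)
          - (c * (c * 1ℤ) * (x * (x * 1ℤ)) + c * Qa) * i₆₄
          ≡ u * u * (u * u) * (d * d) * A₄ * (+ 2 * h - 1ℤ)
            + - (i₆₄ * c * c * (x + d * (u * u) * ω)) * (x - d * (u * u) * ω)
            + - (i₆₄ * c) * (Qa - Qb * (d * (u * u) * (d * (u * u))))
      a₄-identity = solve-∀

    Fmod-≅-by-parity : ∀ C₁ q α β {x ω : ℤ} → ¬ ℓ ℕ.∣ q → ∀ e →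
      x ≋ (+ q) ^ e * ω [mod ℓ ] → (+ q) ^ α ≋ (+ q) ^ β * ((+ q) ^ e * (+ q) ^ e) [mod ℓ ] →
      IsoMod ℓ (Fmod ℓ C₁ q x α) (Fmod ℓ C₁ q ω β)
        ⊎ IsoMod ℓ (Fmod ℓ C₁ q x α) (twist ℓ (+ q) (Fmod ℓ C₁ q ω β))
    Fmod-≅-by-parity C₁ q α β ℓ∤q e x≋tω qᵅ≋ with parity e
    ... | j , inj₁ refl = inj₁ (Fmod-≅ C₁ q α β ((+ q) ^ j) _ (^≢0[mod] ℓ-prime ℓ∤q j)
                                  (^-distribˡ-+-* (+ q) j j) x≋tω qᵅ≋)
    ... | j , inj₂ refl = inj₂ (Fmod-≅-twist C₁ q α β (+ q) ((+ q) ^ j) _ (^≢0[mod] ℓ-prime ℓ∤q j)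
                                  (cong (+ q *_) (^-distribˡ-+-* (+ q) j j)) x≋tω qᵅ≋)

  module Reduction (C₁ q x y α β p ℓ m d : ℕ) (ℓ-prime : Prime ℓ)
    (ℓ≡2mp+1 : ℓ ≡ 2 ℕ.* m ℕ.* p ℕ.+ 1) (ℓ∤2qC₁y : ¬ ℓ ℕ.∣ 2 ℕ.* q ℕ.* C₁ ℕ.* y)
    (eqn : C₁ ℕ.* x ℕ.^ 2 ℕ.+ q ℕ.^ α ≡ y ℕ.^ p) (α≡β+2dp : α ≡ β ℕ.+ d ℕ.* (2 ℕ.* p)) where

    private
      ℓ∤2 : ¬ ℓ ℕ.∣ 2
      ℓ∤2 ℓ∣2 = ℓ∤2qC₁y (ℕ.∣-trans ℓ∣2 (ℕ.∣-trans (ℕ.m∣m*n q) (ℕ.∣-trans (ℕ.m∣m*n C₁) (ℕ.m∣m*n y))))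
      ℓ∤q : ¬ ℓ ℕ.∣ q
      ℓ∤q ℓ∣q = ℓ∤2qC₁y (ℕ.∣-trans ℓ∣q (ℕ.∣-trans (ℕ.n∣m*n 2) (ℕ.∣-trans (ℕ.m∣m*n C₁) (ℕ.m∣m*n y))))
      ℓ∤y : ¬ ℓ ℕ.∣ y
      ℓ∤y ℓ∣y = ℓ∤2qC₁y (ℕ.∣-trans ℓ∣y (ℕ.n∣m*n (2 ℕ.* q ℕ.* C₁)))

      e : ℕ
      e = d ℕ.* p

      t : ℤ
      t = (+ q) ^ e

      qᵅ≡qᵝt² : (+ q) ^ α ≡ (+ q) ^ β * (t * t)
      qᵅ≡qᵝt² = begin
        (+ q) ^ α
          ≡⟨ cong ((+ q) ^_) (trans α≡β+2dp (cong (β ℕ.+_) (double d p))) ⟩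
        (+ q) ^ (β ℕ.+ (e ℕ.+ e))
          ≡⟨ ^-distribˡ-+-* (+ q) β (e ℕ.+ e) ⟩
        (+ q) ^ β * (+ q) ^ (e ℕ.+ e)
          ≡⟨ cong ((+ q) ^ β *_) (^-distribˡ-+-* (+ q) e e) ⟩
        (+ q) ^ β * (t * t) ∎
        where
        open ≡-Reasoning
        double : ∀ d p → d ℕ.* (2 ℕ.* p) ≡ d ℕ.* p ℕ.+ d ℕ.* p
        double = ℕ-solve-∀

      quotient : ∃[ ω ] ω ℕ.< ℓ × + x ≋ + (q ℕ.^ e) * + ω [mod ℓ ]
      quotient = mod-quotient ℓ-prime (∤-^ ℓ-prime ℓ∤q e) x

    ω : ℕ
    ω = proj₁ quotient

    ω<ℓ : ω ℕ.< ℓ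
    ω<ℓ = proj₁ (proj₂ quotient)

    x≋tω : + x ≋ t * + ω [mod ℓ ]
    x≋tω = subst (λ z → + x ≋ z * + ω [mod ℓ ]) (pos-^ q e) (proj₂ (proj₂ quotient))

    private
      ℓ-1≡2mp : ℓ ℕ.∸ 1 ≡ 2 ℕ.* m ℕ.* p
      ℓ-1≡2mp = trans (cong (ℕ._∸ 1) ℓ≡2mp+1) (ℕ.m+n∸n≡m _ 1)

      [t²]²ᵐ≋1 : (t * t) ^ (2 ℕ.* m) ≋ 1ℤ [mod ℓ ]
      [t²]²ᵐ≋1 = subst (_≋ 1ℤ [mod ℓ ]) (begin
        (+ q) ^ ((ℓ ℕ.∸ 1) ℕ.* (d ℕ.+ d))
          ≡⟨ cong (λ k → (+ q) ^ (k ℕ.* (d ℕ.+ d))) ℓ-1≡2mp ⟩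
        (+ q) ^ (2 ℕ.* m ℕ.* p ℕ.* (d ℕ.+ d))
          ≡⟨ cong ((+ q) ^_) (exponent m p d) ⟩
        (+ q) ^ ((e ℕ.+ e) ℕ.* (2 ℕ.* m))
          ≡⟨ ^-*-assoc (+ q) (e ℕ.+ e) (2 ℕ.* m) ⟨
        ((+ q) ^ (e ℕ.+ e)) ^ (2 ℕ.* m)
          ≡⟨ cong (_^ (2 ℕ.* m)) (^-distribˡ-+-* (+ q) e e) ⟩
        (t * t) ^ (2 ℕ.* m) ∎) (fermat-little-power ℓ-prime ℓ∤q (d ℕ.+ d))
        where
        open ≡-Reasoning
        exponent : ∀ m p d → 2 ℕ.* m ℕ.* p ℕ.* (d ℕ.+ d) ≡ (d ℕ.* p ℕ.+ d ℕ.* p) ℕ.* (2 ℕ.* m)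
        exponent = ℕ-solve-∀

      [yᵖ]²ᵐ≋1 : ((+ y) ^ p) ^ (2 ℕ.* m) ≋ 1ℤ [mod ℓ ]
      [yᵖ]²ᵐ≋1 = subst (_≋ 1ℤ [mod ℓ ]) (begin
        (+ y) ^ ((ℓ ℕ.∸ 1) ℕ.* 1)       ≡⟨ cong (λ k → (+ y) ^ (k ℕ.* 1)) ℓ-1≡2mp ⟩
        (+ y) ^ (2 ℕ.* m ℕ.* p ℕ.* 1)   ≡⟨ cong ((+ y) ^_) (exponent m p) ⟩
        (+ y) ^ (p ℕ.* (2 ℕ.* m))       ≡⟨ ^-*-assoc (+ y) p (2 ℕ.* m) ⟨
        ((+ y) ^ p) ^ (2 ℕ.* m)         ∎) (fermat-little-power ℓ-prime ℓ∤y 1)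
        where
        open ≡-Reasoning
        exponent : ∀ m p → 2 ℕ.* m ℕ.* p ℕ.* 1 ≡ p ℕ.* (2 ℕ.* m)
        exponent = ℕ-solve-∀

      eqnℤ : + C₁ * (+ x) ^ 2 + (+ q) ^ β * (t * t) ≡ (+ y) ^ p
      eqnℤ = begin
        + C₁ * (+ x) ^ 2 + (+ q) ^ β * (t * t) ≡⟨ cong (λ z → + C₁ * (+ x) ^ 2 + z) qᵅ≡qᵝt² ⟨
        + C₁ * (+ x) ^ 2 + (+ q) ^ α
          ≡⟨ cong₂ (λ a b → + C₁ * a + b) (pos-^ x 2) (pos-^ q α) ⟨
        + C₁ * + (x ℕ.^ 2) + + (q ℕ.^ α)       ≡⟨ cong (_+ + (q ℕ.^ α)) (pos-* C₁ (x ℕ.^ 2)) ⟨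
        + (C₁ ℕ.* x ℕ.^ 2) + + (q ℕ.^ α)       ≡⟨ pos-+ (C₁ ℕ.* x ℕ.^ 2) (q ℕ.^ α) ⟨
        + (C₁ ℕ.* x ℕ.^ 2 ℕ.+ q ℕ.^ α)         ≡⟨ cong +_ eqn ⟩
        + (y ℕ.^ p)                            ≡⟨ pos-^ y p ⟩
        (+ y) ^ p                              ∎
        where open ≡-Reasoning

      t²A≋yᵖ : t * t * (+ C₁ * (+ ω) ^ 2 + (+ q) ^ β) ≋ (+ y) ^ p [mod ℓ ]
      t²A≋yᵖ = subst (λ z → t * t * (+ C₁ * (+ ω) ^ 2 + (+ q) ^ β) ≋ z [mod ℓ ]) eqnℤ
                 (≋-by (split (+ C₁) (+ x) (+ ω) t ((+ q) ^ β)) (- (+ C₁ * (+ x + t * + ω)) ⊛ x≋tω))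
        where
        split : ∀ c x ω t Qβ → t * t * (c * (ω * (ω * 1ℤ)) + Qβ) - (c * (x * (x * 1ℤ)) + Qβ * (t * t))
                               ≡ - (c * (x + t * ω)) * (x - t * ω)
        split = solve-∀

    norm-≋1 : (+ C₁ * (+ ω) ^ 2 + (+ q) ^ β) ^ (2 ℕ.* m) ≋ 1ℤ [mod ℓ ]
    norm-≋1 = ^≋1-cancelˡ (2 ℕ.* m) [t²]²ᵐ≋1 t²A≋yᵖ [yᵖ]²ᵐ≋1

    reduction-≅ : IsoMod ℓ (Fmod ℓ C₁ q (+ x) α) (Fmod ℓ C₁ q (+ ω) β)
               ⊎ IsoMod ℓ (Fmod ℓ C₁ q (+ x) α) (twist ℓ (+ q) (Fmod ℓ C₁ q (+ ω) β))
    reduction-≅ = Fmod-≅-by-parity ℓ-prime ℓ∤2 C₁ q α β ℓ∤q e x≋tω (≡⇒≋ qᵅ≡qᵝt²)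

open import Defs
open import Data.Nat using (ℕ; _*_; _+_; _^_; _<_; _≥_)
open import Data.Nat.Divisibility using (_∣_)
open import Data.Nat.GCD using (gcd)
open import Data.Nat.Primality using (Prime)
open import Data.Integer as ℤ using (+_)
open import Data.Product using (Σ; ∃-syntax; _×_; _,_; proj₁; proj₂)
open import Data.Sum using (_⊎_)
open import Relation.Binary.PropositionalEquality using (_≡_)
open import Relation.Nullary using (¬_)
open Modular using (≋⇒≡[mod]; ≡[mod]⇒≡+*; module Reduction)

lemma7p1 : (C₁ q x y α p ℓ m : ℕ) →
    0 < C₁ → SquareFree C₁ → Prime q →
    C₁ * x ^ 2 + q ^ α ≡ y ^ p →
    gcd (gcd (C₁ * x) q) y ≡ 1 →
    0 < x → 0 < y → 0 < α → 2 ∣ y →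
    Prime p → p ≥ 11 →
    Prime ℓ → 0 < m → ℓ ≡ 2 * m * p + 1 → ¬ (ℓ ∣ 2 * q * C₁ * y) →
    (β : ℕ) → β < 2 * p → (+ α) ≡ (+ β) [mod 2 * p ] →
    Σ ℕ λ ω → ω < ℓ ×
      (((+ C₁) ℤ.* (+ ω) ℤ.^ 2 ℤ.+ (+ q) ℤ.^ β) ℤ.^ (2 * m) ≡ (+ 1) [mod ℓ ]) ×
      (IsoMod ℓ (Fmod ℓ C₁ q (+ x) α) (Fmod ℓ C₁ q (+ ω) β)
        ⊎ IsoMod ℓ (Fmod ℓ C₁ q (+ x) α) (twist ℓ (+ q) (Fmod ℓ C₁ q (+ ω) β)))
lemma7p1 C₁ q x y α p ℓ m _ _ _ eqn _ _ _ _ _ _ _ ℓ-prime _ ℓ≡ ℓ∤2qC₁y β β<2p α≡β =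
  ω , ω<ℓ , ≋⇒≡[mod] norm-≋1 , reduction-≅
  where
  α≡β+2dp : ∃[ d ] α ≡ β + d * (2 * p)
  α≡β+2dp = ≡[mod]⇒≡+* α β<2p α≡β
  open Reduction C₁ q x y α β p ℓ m (proj₁ α≡β+2dp) ℓ-prime ℓ≡ ℓ∤2qC₁y eqn (proj₂ α≡β+2dp)
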